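{- Let $M$ be a positive integer and let $\mathbf{v}=v_0v_1v_2\cdots$ be the periodic integer sequence defined by $v_n=2^{\,n\bmod M}$ if $n\not\equiv-1\pmod M$ and $v_n=1-2^{M-1}$ if $n\equiv-1\pmod M$. If $x$ and $y$ are factors of $\mathbf{v}$ with $\sum x=\sum y$, then $|x|\equiv|y|\pmod M$.
   Context: For a finite word $x$ whose letters are integers, $\sum x$ denotes the sum of its letters; $n\bmod M\in\{0,\dots,M-1\}$ is the remainder. -}

module Defs where

open import Data.Nat using (ℕ; zero; suc; _+_; _^_; NonZero)
open import Data.Nat.DivMod using (_%_)
open import Data.Integer as ℤ using (ℤ; +_)
open import Data.List using (List; []; _∷_; map; upTo)
open import Data.Product using (∃; _×_)
open import Data.Bool using (if_then_else_)
open import Relation.Nullary.Decidable using (⌊_⌋)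
open import Relation.Binary.PropositionalEquality using (_≡_)

v : (M : ℕ) → .{{NonZero M}} → ℕ → ℤ
v M n = if ⌊ suc (n % M) Data.Nat.≟ M ⌋
        then (+ 1) ℤ.- (+ (2 ^ (n % M)))
        else + (2 ^ (n % M))

sumℤ : List ℤ → ℤ
sumℤ [] = + 0
sumℤ (a ∷ w) = a ℤ.+ sumℤ w

factorAt : (M : ℕ) → .{{NonZero M}} → ℕ → ℕ → List ℤ
factorAt M i zero = []
factorAt M i (suc k) = v M i ∷ factorAt M (suc i) k

IsFactor : (M : ℕ) → .{{NonZero M}} → List ℤ → Set
IsFactor M x = ∃ λ i → ∃ λ k → factorAt M i k ≡ x

module Submission where

-- Write  w n = 2 ^ (n mod M).  The letters of v
-- telescope:  v n = w (n + 1) - w n  (for n ≡ -1 this reads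
-- 1 - 2^(M-1) = 2^0 - 2^(M-1)).  Hence the factor of length k starting
-- at position i has sum  w (i + k) - w i,  and  Σx = Σy  for the
-- factors (i, k) and (j, l) becomes the identity of natural numbers
--   2^((i+k) mod M) + 2^(j mod M) = 2^((j+l) mod M) + 2^(i mod M).
-- Such a sum of two powers of two determines its exponents as an
-- unordered pair, so either (i+k ≡ j+l and j ≡ i) or (i+k ≡ i and
-- j+l ≡ j) mod M; cancelling modulo M gives k ≡ l in both cases.

open import Defs
open import Data.Nat using (ℕ; NonZero; zero; suc; _+_; _*_; _∸_; _^_; _≟_; s≤s; z≤n)
open import Data.Nat.DivMod using (_%_; %-distribˡ-+; m%n%n≡m%n; [m+n]%n≡m%n; n%n≡0; m<n⇒m%n≡m; m%n<n)
open import Data.Nat.Properties using (<-cmp; <⇒≢; >⇒≢; ^-monoʳ-<; m^n>0; *-monoʳ-≤; +-mono-≤; even≢odd; *-cancelˡ-≡; *-distribˡ-+; suc-injective; +-comm; +-assoc; +-identityʳ; +-suc; m∸n+n≡m; <⇒≤; ≤∧≢⇒<)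
open import Data.List using (List; length)
open import Data.Integer as ℤ using (ℤ; +_)
open import Data.Integer.Properties using (+-injective)
open import Data.Integer.Tactic.RingSolver using (solve-∀)
open import Data.Product as Prod using (_×_; _,_)
open import Data.Sum as Sum using (_⊎_; inj₁; inj₂)
open import Data.Empty using (⊥-elim)
open import Function using (_∘′_)
open import Relation.Nullary using (yes; no; ¬_)
open import Relation.Binary.Definitions using (tri<; tri≈; tri>)
open import Relation.Binary.PropositionalEquality
open ≡-Reasoning

_≐_ : ℕ × ℕ → ℕ × ℕ → Set
(a , b) ≐ (c , d) = (a ≡ c × b ≡ d) ⊎ (a ≡ d × b ≡ c)

≐-sym : ∀ {a b c d} → (a , b) ≐ (c , d) → (c , d) ≐ (a , b)
≐-sym = Sum.map (Prod.map sym sym) (λ { (a≡d , b≡c) → sym b≡c , sym a≡d })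

≐-swapˡ : ∀ {a b c d} → (b , a) ≐ (c , d) → (a , b) ≐ (c , d)
≐-swapˡ = Sum.swap ∘′ Sum.map Prod.swap Prod.swap

≐-swapʳ : ∀ {a b c d} → (a , b) ≐ (d , c) → (a , b) ≐ (c , d)
≐-swapʳ = Sum.swap

pow-injective : ∀ {a b} → 2 ^ a ≡ 2 ^ b → a ≡ b
pow-injective {a} {b} e with <-cmp a b
... | tri< a<b _ _ = ⊥-elim (<⇒≢ (^-monoʳ-< 2 (s≤s (s≤s z≤n)) a<b) e)
... | tri≈ _ a≡b _ = a≡b
... | tri> _ _ b<a = ⊥-elim (>⇒≢ (^-monoʳ-< 2 (s≤s (s≤s z≤n)) b<a) e)

pow-sum≡2 : ∀ a b → 2 ^ a + 2 ^ b ≡ 2 → a ≡ 0 × b ≡ 0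
pow-sum≡2 zero zero _ = refl , refl
pow-sum≡2 (suc a) b e =
  ⊥-elim (<⇒≢ (+-mono-≤ (*-monoʳ-≤ 2 (m^n>0 2 a)) (m^n>0 2 b)) (sym e))
pow-sum≡2 zero (suc b) e =
  Prod.swap (pow-sum≡2 (suc b) zero (trans (+-comm (2 ^ suc b) 1) e))

odd≢even+even : ∀ x y z → ¬ (1 + 2 * x ≡ 2 * y + 2 * z)
odd≢even+even x y z e = even≢odd (y + z) x (trans (*-distribˡ-+ 2 y z) (sym e))

halve : ∀ a b c d → 2 ^ suc a + 2 ^ suc b ≡ 2 ^ suc c + 2 ^ suc d →
        2 ^ a + 2 ^ b ≡ 2 ^ c + 2 ^ d
halve a b c d e = *-cancelˡ-≡ _ _ 2 (begin
  2 * (2 ^ a + 2 ^ b)         ≡⟨ *-distribˡ-+ 2 (2 ^ a) (2 ^ b) ⟩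
  2 ^ suc a + 2 ^ suc b       ≡⟨ e ⟩
  2 ^ suc c + 2 ^ suc d       ≡⟨ sym (*-distribˡ-+ 2 (2 ^ c) (2 ^ d)) ⟩
  2 * (2 ^ c + 2 ^ d)         ∎)

odd-pow-sum : ∀ b c d → 2 ^ 0 + 2 ^ suc b ≡ 2 ^ c + 2 ^ d → (0 , suc b) ≐ (c , d)
odd-pow-sum b zero zero e = inj₁ (pow-sum≡2 zero (suc b) e)
odd-pow-sum b zero (suc d) e =
  inj₁ (refl , cong suc (pow-injective (*-cancelˡ-≡ _ _ 2 (suc-injective e))))
odd-pow-sum b (suc c) zero e =
  inj₂ (refl , cong suc (pow-injective (*-cancelˡ-≡ _ _ 2
    (suc-injective (trans e (+-comm (2 ^ suc c) 1))))))
odd-pow-sum b (suc c) (suc d) e = ⊥-elim (odd≢even+even (2 ^ b) (2 ^ c) (2 ^ d) e)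

-- A sum of two powers of two determines the exponents up to order
-- (uniqueness of binary expansions, allowing a repeated power):
-- odd sums are handled by odd-pow-sum, even sums are halved.
two-powers : ∀ a b c d → 2 ^ a + 2 ^ b ≡ 2 ^ c + 2 ^ d → (a , b) ≐ (c , d)
two-powers a b zero zero e = inj₁ (pow-sum≡2 a b e)
two-powers zero zero c d e = ≐-sym (inj₁ (pow-sum≡2 c d (sym e)))
two-powers zero (suc b) c d e = odd-pow-sum b c d e
two-powers (suc a) zero c d e =
  ≐-swapˡ (odd-pow-sum a c d (trans (+-comm 1 (2 ^ suc a)) e))
two-powers (suc a) (suc b) zero (suc d) e = ≐-sym (odd-pow-sum d (suc a) (suc b) (sym e))
two-powers (suc a) (suc b) (suc c) zero e =
  ≐-swapʳ (≐-sym (odd-pow-sum c (suc a) (suc b) (trans (+-comm 1 (2 ^ suc c)) (sym e))))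
two-powers (suc a) (suc b) (suc c) (suc d) e =
  Sum.map (Prod.map (cong suc) (cong suc)) (Prod.map (cong suc) (cong suc))
          (two-powers a b c d (halve a b c d e))

module _ (M : ℕ) .{{_ : NonZero M}} where

  +-mod-cong : ∀ {a b x y} → a % M ≡ b % M → x % M ≡ y % M →
               (a + x) % M ≡ (b + y) % M
  +-mod-cong {a} {b} {x} {y} ha hx = begin
    (a + x) % M             ≡⟨ %-distribˡ-+ a x M ⟩
    (a % M + x % M) % M     ≡⟨ cong₂ (λ s t → (s + t) % M) ha hx ⟩
    (b % M + y % M) % M     ≡⟨ sym (%-distribˡ-+ b y M) ⟩
    (b + y) % M             ∎

  mod-offset : ∀ i k → k % M ≡ ((M ∸ i % M) + (i + k)) % M
  mod-offset i k = begin
    k % M                          ≡⟨ sym ([m+n]%n≡m%n k M) ⟩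
    (k + M) % M                    ≡⟨ cong (_% M) (+-comm k M) ⟩
    (M + k) % M                    ≡⟨ cong (λ t → (t + k) % M) (sym (m∸n+n≡m (<⇒≤ (m%n<n i M)))) ⟩
    ((M ∸ i % M) + i % M + k) % M  ≡⟨ cong (_% M) (+-assoc (M ∸ i % M) (i % M) k) ⟩
    ((M ∸ i % M) + (i % M + k)) % M
      ≡⟨ +-mod-cong {a = M ∸ i % M} refl (+-mod-cong {x = k} (m%n%n≡m%n i M) refl) ⟩
    ((M ∸ i % M) + (i + k)) % M    ∎

  +-cancelˡ-mod : ∀ {i j k l} → i % M ≡ j % M → (i + k) % M ≡ (j + l) % M →
                  k % M ≡ l % M
  +-cancelˡ-mod {i} {j} {k} {l} hi hik = begin
    k % M                        ≡⟨ mod-offset i k ⟩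
    ((M ∸ i % M) + (i + k)) % M  ≡⟨ +-mod-cong (cong (λ r → (M ∸ r) % M) hi) hik ⟩
    ((M ∸ j % M) + (j + l)) % M  ≡⟨ sym (mod-offset j l) ⟩
    l % M                        ∎

  w : ℕ → ℤ
  w n = + (2 ^ (n % M))

  suc-mod : ∀ n → suc n % M ≡ suc (n % M) % M
  suc-mod n = +-mod-cong {1} {1} refl (sym (m%n%n≡m%n n M))

  v-telescopes : ∀ n → v M n ℤ.+ w n ≡ w (suc n)
  v-telescopes n with suc (n % M) ≟ M
  ... | yes wraps = begin
    (+ 1 ℤ.- w n) ℤ.+ w n  ≡⟨ cancel (+ 1) (w n) ⟩
    + 1                    ≡⟨ cong (λ t → + (2 ^ t)) (sym suc-n%M≡0) ⟩
    w (suc n)              ∎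
    where
      cancel : ∀ a b → (a ℤ.- b) ℤ.+ b ≡ a
      cancel = solve-∀
      suc-n%M≡0 : suc n % M ≡ 0
      suc-n%M≡0 = trans (suc-mod n) (trans (cong (_% M) wraps) (n%n≡0 M))
  ... | no ¬wraps = cong +_ (begin
    2 ^ (n % M) + 2 ^ (n % M)   ≡⟨ cong (λ t → 2 ^ (n % M) + t) (sym (+-identityʳ _)) ⟩
    2 ^ suc (n % M)             ≡⟨ cong (2 ^_) (sym suc-n%M) ⟩
    2 ^ (suc n % M)             ∎)
    where
      suc-n%M : suc n % M ≡ suc (n % M)
      suc-n%M = trans (suc-mod n) (m<n⇒m%n≡m (≤∧≢⇒< (m%n<n n M) ¬wraps))

  factor-sum : ∀ i k → sumℤ (factorAt M i k) ℤ.+ w i ≡ w (i + k)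
  factor-sum i zero = cong w (sym (+-identityʳ i))
  factor-sum i (suc k) = begin
    (v M i ℤ.+ S) ℤ.+ w i    ≡⟨ rearrange (v M i) S (w i) ⟩
    S ℤ.+ (v M i ℤ.+ w i)    ≡⟨ cong (λ t → S ℤ.+ t) (v-telescopes i) ⟩
    S ℤ.+ w (suc i)          ≡⟨ factor-sum (suc i) k ⟩
    w (suc i + k)            ≡⟨ cong w (sym (+-suc i k)) ⟩
    w (i + suc k)            ∎
    where
      S : ℤ
      S = sumℤ (factorAt M (suc i) k)
      rearrange : ∀ a b c → (a ℤ.+ b) ℤ.+ c ≡ b ℤ.+ (a ℤ.+ c)
      rearrange = solve-∀

  length-factorAt : ∀ i k → length (factorAt M i k) ≡ k
  length-factorAt i zero = refl
  length-factorAt i (suc k) = cong suc (length-factorAt (suc i) k)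

  equal-sums : ∀ i k j l → sumℤ (factorAt M i k) ≡ sumℤ (factorAt M j l) →
    2 ^ ((i + k) % M) + 2 ^ (j % M) ≡ 2 ^ ((j + l) % M) + 2 ^ (i % M)
  equal-sums i k j l eq = +-injective (begin
    w (i + k) ℤ.+ w j          ≡⟨ cong (λ t → t ℤ.+ w j) (sym (factor-sum i k)) ⟩
    (s ℤ.+ w i) ℤ.+ w j        ≡⟨ right-comm s (w i) (w j) ⟩
    (s ℤ.+ w j) ℤ.+ w i        ≡⟨ cong (λ t → (t ℤ.+ w j) ℤ.+ w i) eq ⟩
    (s′ ℤ.+ w j) ℤ.+ w i       ≡⟨ cong (λ t → t ℤ.+ w i) (factor-sum j l) ⟩
    w (j + l) ℤ.+ w i          ∎)
    where
      s s′ : ℤ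
      s = sumℤ (factorAt M i k)
      s′ = sumℤ (factorAt M j l)
      right-comm : ∀ a b c → (a ℤ.+ b) ℤ.+ c ≡ (a ℤ.+ c) ℤ.+ b
      right-comm = solve-∀

mainTheorem13 : (M : ℕ) → .{{_ : NonZero M}} → (x y : List ℤ) →
    IsFactor M x → IsFactor M y → sumℤ x ≡ sumℤ y →
    length x % M ≡ length y % M
mainTheorem13 M _ _ (i , k , refl) (j , l , refl) eq
  rewrite length-factorAt M i k | length-factorAt M j l
  with two-powers _ _ _ _ (equal-sums M i k j l eq)
... | inj₁ (i+k≡j+l , j≡i) = +-cancelˡ-mod M (sym j≡i) i+k≡j+l
-- Both factors have sum 0:  i + k ≡ i  and  j + l ≡ j  mod M.
... | inj₂ (i+k≡i , j≡j+l) =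
  trans (period i+k≡i) (sym (period (sym j≡j+l)))
  where
    period : ∀ {m n} → (m + n) % M ≡ m % M → n % M ≡ 0 % M
    period {m} e = +-cancelˡ-mod M refl (trans e (cong (_% M) (sym (+-identityʳ m))))
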